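{- Let $\Sigma$ be a renamed-apart rule set and $\mathcal{D}$ a database such that $\Sigma$ and $\mathcal{D}$ have a core model, and let $q$ be a normal Boolean conjunctive query that is affection-safe with respect to $\Sigma$. Let $\mathcal{M}$ be any chase of $\Sigma$ and $\mathcal{D}$ computed by a chase procedure compatible with jointly affected positions (e.g. the restricted, Skolem or oblivious chase). Then $\Sigma,\mathcal{D}\models_c q$ if and only if $\mathcal{M}\models q$.
   Context: Fix pairwise disjoint sets of constants, nulls, variables and predicates with arities. An interpretation is a set of variable-free atoms; a database is a finite set of ground (constant-only) atoms. An existential rule is $\forall\vec x,\vec y.\,\varphi[\vec x,\vec y]\to\exists\vec z.\,\psi[\vec y,\vec z]$ (body/head conjunctions of atoms, frontier $\vec y$ occurring in the body); a rule set is a finite set of rules, renamed-apart if no variable occurs in two rules. Homomorphisms fix constants and preserve atoms; isomorphisms are bijective homomorphisms with homomorphic inverse. A model of $\Sigma$ and $\mathcal{D}$ is an interpretation containing $\mathcal{D}$ in which every homomorphism from a rule body extends to one of the rule head; universal models map homomorphically into every model. A finite interpretation is a core if all its endomorphisms are isomorphisms; a core model is a finite universal model that is a core. Restricted chase: $\mathcal{D}^0=\mathcal{D}$, $\mathcal{D}^{i+1}=\mathcal{D}^i\cup h^\star(\mathrm{head}(\rho))$ for a rule $\rho\in\Sigma$ and a match $h$ of its body in $\mathcal{D}^i$ that does not extend to a homomorphism of the head into $\mathcal{D}^i$, where $h^\star$ maps existential variables to fresh nulls; fair (every match is eventually satisfied); the chase is the union. (Skolem and oblivious chases differ only in when a match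 may be applied.) A chase procedure is compatible with jointly affected positions if its results are universal models of $\Sigma$ and $\mathcal{D}$ in which nulls only occur at jointly affected positions. Positions: $\langle p,i\rangle$, $1\le i\le\mathrm{ar}(p)$. For a variable $x$ of $\Sigma$, $\Pi^B_x$ ($\Pi^H_x$) is the set of positions where $x$ occurs in the body (head) of its rule. For an existentially quantified $x$, $\Omega_x$ is the smallest set of positions containing $\Pi^H_x$ such that for every universally quantified $y$, $\Pi^B_y\subseteq\Omega_x$ implies $\Pi^H_y\subseteq\Omega_x$. Jointly affected positions are $\bigcup_x\Omega_x$ over existential $x$. A normal Boolean conjunctive query (BNCQ) is $q=\exists\vec x.\,\varphi\wedge\psi$, $\varphi$ a conjunction of atoms (set $q^+$), $\psi$ a conjunction of negated atoms (set $q^-$ of the un-negated atoms) with variables occurring in $\varphi$, $q^+\cap q^-=\emptyset$; $I\models q$ iff some homomorphism $h:q^+\to I$ has $h(q^-)\cap I=\emptyset$. $q$ is affection-safe w.r.t. $\Sigma$ if every variable in $q^-$ occurs at a position in $q^+$ that is not jointly affected. $\Sigma,\mathcal{D}\models_c q$ means some core model of $\Sigma$ and $\mathcal{D}$ satisfies $q$. -}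

module Defs where

open import Data.Nat using (ℕ)
open import Data.Fin using (Fin)
open import Data.Vec using (Vec; lookup; map)
open import Data.List using (List; length)
import Data.List as L
open import Data.List.Membership.Propositional using (_∈_)
open import Data.Product using (Σ; ∃; ∃-syntax; _×_; _,_)
open import Data.Sum using (_⊎_; inj₁; inj₂)
open import Data.Empty using (⊥)
open import Relation.Nullary using (¬_)
open import Relation.Binary.PropositionalEquality using (_≡_)
open import Function.Bundles using (_⇔_)

-- The fixed signature: pairwise disjoint sets of constants, nulls,
-- variables and predicates (disjointness is built in by using ⊎ below),
-- together with the arity function.
record Sig : Set₁ where
  field
    Const : Set
    Null  : Set
    Var   : Set
    Pred  : Set
    ar    : Pred → ℕ

module Syntax (S : Sig) where
  open Sig S public

  record Atom (T : Set) : Set where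
    constructor atom
    field
      pred : Pred
      args : Vec T (ar pred)
  open Atom public

  mapAtom : {A B : Set} → (A → B) → Atom A → Atom B
  mapAtom f (atom p ts) = atom p (map f ts)

  Term : Set
  Term = Const ⊎ Null

  RTerm : Set
  RTerm = Const ⊎ Var

  -- positions ⟨p,i⟩ (Fin is 0-based; i ranges over the ar(p) arguments)
  Position : Set
  Position = Σ Pred (λ p → Fin (ar p))

  Interp : Set₁
  Interp = Atom Term → Set

  Database : Set
  Database = List (Atom Const)

  record Rule : Set where
    constructor rule
    field
      body : List (Atom RTerm)
      head : List (Atom RTerm)
  open Rule public

  RuleSet : Set
  RuleSet = List Rule

  OccursIn : Var → List (Atom RTerm) → Set
  OccursIn x as = ∃[ a ] (a ∈ as × ∃[ i ] (lookup (args a) i ≡ inj₂ x))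

  OccursAt : Var → List (Atom RTerm) → Position → Set
  OccursAt x as pos =
    ∃[ a ] (a ∈ as × ∃[ i ] ((pred a , i) ≡ pos × lookup (args a) i ≡ inj₂ x))

  OccursInRule : Var → Rule → Set
  OccursInRule x ρ = OccursIn x (body ρ) ⊎ OccursIn x (head ρ)

  RenamedApart : RuleSet → Set
  RenamedApart Σs = (i j : Fin (length Σs)) (x : Var) →
    OccursInRule x (L.lookup Σs i) → OccursInRule x (L.lookup Σs j) → i ≡ j

  ΠB : RuleSet → Var → Position → Set
  ΠB Σs x pos = ∃[ ρ ] (ρ ∈ Σs × OccursAt x (body ρ) pos)

  ΠH : RuleSet → Var → Position → Set
  ΠH Σs x pos = ∃[ ρ ] (ρ ∈ Σs × OccursAt x (head ρ) pos)

  UniversallyQuantified : RuleSet → Var → Set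
  UniversallyQuantified Σs y = ∃[ ρ ] (ρ ∈ Σs × OccursIn y (body ρ))

  ExistentiallyQuantified : RuleSet → Var → Set
  ExistentiallyQuantified Σs x =
    ∃[ ρ ] (ρ ∈ Σs × OccursIn x (head ρ) × ¬ OccursIn x (body ρ))

  -- Ω_x: the least set of positions containing Π^H_x and closed under
  -- Π^B_y ⊆ Ω_x ⇒ Π^H_y ⊆ Ω_x for universally quantified y
  -- (inductive definition = least fixed point).
  data Ω (Σs : RuleSet) (x : Var) : Position → Set where
    base : ∀ {pos} → ΠH Σs x pos → Ω Σs x pos
    step : ∀ {pos} (y : Var) → UniversallyQuantified Σs y →
           (∀ pos' → ΠB Σs y pos' → Ω Σs x pos') →
           ΠH Σs y pos → Ω Σs x pos

  JointlyAffected : RuleSet → Position → Set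
  JointlyAffected Σs pos = ∃[ x ] (ExistentiallyQuantified Σs x × Ω Σs x pos)

  substTerm : (Var → Term) → RTerm → Term
  substTerm σ (inj₁ c) = inj₁ c
  substTerm σ (inj₂ v) = σ v

  substAtom : (Var → Term) → Atom RTerm → Atom Term
  substAtom σ = mapAtom (substTerm σ)

  groundAtom : Atom Const → Atom Term
  groundAtom = mapAtom inj₁

  IsHom : Interp → Interp → (Term → Term) → Set
  IsHom I J h = (∀ c → h (inj₁ c) ≡ inj₁ c) × (∀ a → I a → J (mapAtom h a))

  TermOf : Interp → Term → Set
  TermOf I t = ∃[ a ] (I a × ∃[ i ] (lookup (args a) i ≡ t))

  IsIso : Interp → Interp → (Term → Term) → Set
  IsIso I J h = IsHom I J h × ∃[ g ] (IsHom J I g ×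
                  (∀ t → TermOf I t → g (h t) ≡ t) ×
                  (∀ t → TermOf J t → h (g t) ≡ t))

  Finite : Interp → Set
  Finite I = ∃[ l ] (∀ a → I a → a ∈ l)

  IsCore : Interp → Set
  IsCore I = Finite I × (∀ h → IsHom I I h → IsIso I I h)

  SatisfiesRule : Interp → Rule → Set
  SatisfiesRule I ρ = ∀ (σ : Var → Term) →
    (∀ a → a ∈ body ρ → I (substAtom σ a)) →
    ∃[ σ' ] ((∀ y → OccursIn y (body ρ) → σ' y ≡ σ y) ×
             (∀ a → a ∈ head ρ → I (substAtom σ' a)))

  IsModel : RuleSet → Database → Interp → Set
  IsModel Σs D I = (∀ a → a ∈ D → I (groundAtom a)) ×
                   (∀ ρ → ρ ∈ Σs → SatisfiesRule I ρ)

  IsUniversalModel : RuleSet → Database → Interp → Set₁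
  IsUniversalModel Σs D M =
    IsModel Σs D M × (∀ (I : Interp) → IsModel Σs D I → ∃[ h ] IsHom M I h)

  -- finite universal model that is a core (finiteness is part of IsCore)
  IsCoreModel : RuleSet → Database → Interp → Set₁
  IsCoreModel Σs D C = IsUniversalModel Σs D C × IsCore C

  HasCoreModel : RuleSet → Database → Set₁
  HasCoreModel Σs D = ∃[ C ] IsCoreModel Σs D C

  NullsOnlyAtJAP : RuleSet → Interp → Set
  NullsOnlyAtJAP Σs M = ∀ a → M a → ∀ i → (n : Null) →
    lookup (args a) i ≡ inj₂ n → JointlyAffected Σs (pred a , i)

  record Query : Set where
    constructor query
    field
      pos : List (Atom RTerm)
      neg : List (Atom RTerm)
  open Query public

  IsBNCQ : Query → Set
  IsBNCQ q = (∀ x → OccursIn x (neg q) → OccursIn x (pos q)) ×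
             (∀ a → a ∈ pos q → a ∈ neg q → ⊥)

  _⊨_ : Interp → Query → Set
  I ⊨ q = ∃[ σ ] ((∀ a → a ∈ pos q → I (substAtom σ a)) ×
                  (∀ a → a ∈ neg q → ¬ I (substAtom σ a)))

  AffectionSafe : RuleSet → Query → Set
  AffectionSafe Σs q = ∀ x → OccursIn x (neg q) →
    ∃[ p ] (OccursAt x (pos q) p × ¬ JointlyAffected Σs p)

  _,_⊨c_ : RuleSet → Database → Query → Set₁
  Σs , D ⊨c q = ∃[ C ] (IsCoreModel Σs D C × C ⊨ q)

{-# OPTIONS --safe #-}
module Submission where

-- Only the variables of q⁻ matter for transferring a match of q along homomorphisms, and
-- affection-safety forces them onto positions that are not jointly affected.  In the chase M
-- such positions carry constants only, so every match of q⁺ in M is ground on q⁻; since M and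
-- a core model C are homomorphically equivalent and homomorphisms fix constants, a match in
-- M carries over to C.  Conversely, for a match σ in C with g : C → M and h : M → C, g ∘ σ is
-- ground on q⁻, and since the endomorphism h ∘ g of the core C is invertible on its terms, it
-- cannot map a null of C to a constant; so σ is ground on q⁻ as well and carries over to M.

open import Defs
open import Data.Fin using (zero; suc)
open import Data.Vec using (Vec; []; _∷_; lookup; map)
open import Data.Vec.Properties using (map-∘; map-cong; lookup-map)
open import Data.Product using (∃-syntax; _×_; _,_; proj₁; proj₂)
open import Data.Sum using (inj₁; inj₂)
open import Data.List using (List)
open import Data.List.Membership.Propositional using (_∈_)
open import Data.Empty using (⊥-elim)
open import Relation.Nullary using (¬_)
open import Relation.Binary.PropositionalEquality
  using (_≡_; refl; sym; trans; cong; cong₂; subst; module ≡-Reasoning)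
open import Function using (_∘_)
open import Function.Bundles using (_⇔_; mk⇔)

module QueryTransfer (S : Sig) where
  open Syntax S public

  IsConstant : Term → Set
  IsConstant t = ∃[ c ] (t ≡ inj₁ c)

  FixesConstants : (Term → Term) → Set
  FixesConstants f = ∀ c → f (inj₁ c) ≡ inj₁ c

  GroundOn : (Var → Term) → List (Atom RTerm) → Set
  GroundOn σ as = ∀ x → OccursIn x as → IsConstant (σ x)

  SatisfiesAll : Interp → (Var → Term) → List (Atom RTerm) → Set
  SatisfiesAll I σ as = ∀ a → a ∈ as → I (substAtom σ a)

  AvoidsAll : Interp → (Var → Term) → List (Atom RTerm) → Set
  AvoidsAll I σ as = ∀ a → a ∈ as → ¬ I (substAtom σ a)

  Match : Interp → Query → (Var → Term) → Set
  Match I q σ = SatisfiesAll I σ (pos q) × AvoidsAll I σ (neg q)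

  -- Unlike the bare predicate IsHom, the record index lets Agda infer I and J.
  record Hom (I J : Interp) : Set where
    constructor hom
    field
      fun       : Term → Term
      fixes     : FixesConstants fun
      preserves : ∀ a → I a → J (mapAtom fun a)

    isHom : IsHom I J fun
    isHom = fixes , preserves
  open Hom public

  toHom : ∀ {I J} → ∃[ h ] IsHom I J h → Hom I J
  toHom (h , fixes , preserves) = hom h fixes preserves

  lookup-substAtom-var : ∀ σ (a : Atom RTerm) i {x} → lookup (args a) i ≡ inj₂ x →
    lookup (args (substAtom σ a)) i ≡ σ x
  lookup-substAtom-var σ (atom p ts) i {x} ts[i]≡x = begin
    lookup (map (substTerm σ) ts) i ≡⟨ lookup-map i (substTerm σ) ts ⟩
    substTerm σ (lookup ts i)       ≡⟨ cong (substTerm σ) ts[i]≡x ⟩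
    σ x                             ∎
    where open ≡-Reasoning

  map-substTerm-cong : ∀ {n} {σ τ : Var → Term} (ts : Vec RTerm n) →
    (∀ i {x} → lookup ts i ≡ inj₂ x → σ x ≡ τ x) →
    map (substTerm σ) ts ≡ map (substTerm τ) ts
  map-substTerm-cong []            agree = refl
  map-substTerm-cong (inj₁ c ∷ ts) agree =
    cong (inj₁ c ∷_) (map-substTerm-cong ts (λ i → agree (suc i)))
  map-substTerm-cong (inj₂ x ∷ ts) agree =
    cong₂ _∷_ (agree zero refl) (map-substTerm-cong ts (λ i → agree (suc i)))

  substAtom-cong : ∀ {σ τ : Var → Term} (a : Atom RTerm) →
    (∀ i {x} → lookup (args a) i ≡ inj₂ x → σ x ≡ τ x) → substAtom σ a ≡ substAtom τ a
  substAtom-cong (atom p ts) agree = cong (atom p) (map-substTerm-cong ts agree)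

  mapAtom-substAtom : ∀ f → FixesConstants f → ∀ σ (a : Atom RTerm) →
    mapAtom f (substAtom σ a) ≡ substAtom (f ∘ σ) a
  mapAtom-substAtom f fixes σ (atom p ts) =
    cong (atom p) (trans (sym (map-∘ f (substTerm σ) ts)) (map-cong f∘σ-term ts))
    where
    f∘σ-term : ∀ t → f (substTerm σ t) ≡ substTerm (f ∘ σ) t
    f∘σ-term (inj₁ c) = fixes c
    f∘σ-term (inj₂ x) = refl

  substAtom-∘-ground : ∀ f → FixesConstants f → ∀ {σ as a} → GroundOn σ as → a ∈ as →
    substAtom (f ∘ σ) a ≡ substAtom σ a
  substAtom-∘-ground f fixes {σ} {a = a} ground a∈as = substAtom-cong a fσx≡σx
    where
    fσx≡σx : ∀ i {x} → lookup (args a) i ≡ inj₂ x → f (σ x) ≡ σ x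
    fσx≡σx i {x} a[i]≡x with σ x | ground x (a , a∈as , i , a[i]≡x)
    ... | _ | c , refl = fixes c

  mapAtom-∘ : ∀ (f g : Term → Term) (a : Atom Term) → mapAtom f (mapAtom g a) ≡ mapAtom (f ∘ g) a
  mapAtom-∘ f g (atom p ts) = cong (atom p) (sym (map-∘ f g ts))

  _∘ₕ_ : ∀ {I J K} → Hom J K → Hom I J → Hom I K
  _∘ₕ_ {K = K} f g = hom (fun f ∘ fun g)
    (λ c → trans (cong (fun f) (fixes g c)) (fixes f c))
    (λ a Ia → subst K (mapAtom-∘ (fun f) (fun g) a) (preserves f _ (preserves g a Ia)))

  SatisfiesAll-hom : ∀ {I J σ as} (f : Hom I J) → SatisfiesAll I σ as →
    SatisfiesAll J (fun f ∘ σ) as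
  SatisfiesAll-hom {J = J} {σ} f sat a a∈as =
    subst J (mapAtom-substAtom (fun f) (fixes f) σ a) (preserves f _ (sat a a∈as))

  Match-transfer : ∀ {I J σ} q (f : Hom I J) → Hom J I → Match I q σ →
    GroundOn σ (neg q) → Match J q (fun f ∘ σ)
  Match-transfer {I} {J} {σ} q f g (sat , avoid) ground = SatisfiesAll-hom f sat , avoid′
    where
    avoid′ : AvoidsAll J (fun f ∘ σ) (neg q)
    avoid′ a a∈q⁻ Jfσa = avoid a a∈q⁻
      (subst I (trans (mapAtom-substAtom (fun g) (fixes g) σ a)
                      (substAtom-∘-ground (fun g) (fixes g) ground a∈q⁻))
        (preserves g _ (subst J (substAtom-∘-ground (fun f) (fixes f) ground a∈q⁻) Jfσa)))

  term-of-match : ∀ {I σ as x} → SatisfiesAll I σ as → OccursIn x as → TermOf I (σ x)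
  term-of-match {σ = σ} sat (a , a∈as , i , a[i]≡x) =
    substAtom σ a , sat a a∈as , i , lookup-substAtom-var σ a i a[i]≡x

  unaffected-term-constant : ∀ {Σs I σ as x p} → NullsOnlyAtJAP Σs I → SatisfiesAll I σ as →
    OccursAt x as p → ¬ JointlyAffected Σs p → IsConstant (σ x)
  unaffected-term-constant {σ = σ} {x = x} nulls sat (b , b∈as , i , refl , b[i]≡x) unaffected
    with σ x | lookup-substAtom-var σ b i b[i]≡x
  ... | inj₁ c | _        = c , refl
  ... | inj₂ n | σb[i]≡n = ⊥-elim (unaffected (nulls _ (sat b b∈as) i n σb[i]≡n))

  affection-safe-ground : ∀ {Σs I σ} q → AffectionSafe Σs q → NullsOnlyAtJAP Σs I →
    SatisfiesAll I σ (pos q) → GroundOn σ (neg q)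
  affection-safe-ground q safe nulls sat x x∈q⁻ with safe x x∈q⁻
  ... | _ , x∈q⁺ , unaffected = unaffected-term-constant nulls sat x∈q⁺ unaffected

  core-endo-reflects-constants : ∀ {C t c} → IsCore C → (e : Hom C C) → TermOf C t →
    fun e t ≡ inj₁ c → t ≡ inj₁ c
  core-endo-reflects-constants {t = t} {c} (_ , endo-iso) e t∈C et≡c
    with endo-iso (fun e) (isHom e)
  ... | _ , k , (k-fixes , _) , k∘e≡id , _ = begin
    t              ≡⟨ sym (k∘e≡id t t∈C) ⟩
    k (fun e t)    ≡⟨ cong k et≡c ⟩
    k (inj₁ c)     ≡⟨ k-fixes c ⟩
    inj₁ c         ∎
    where open ≡-Reasoning

  core-ground-reflect : ∀ {C M σ as bs} → IsCore C → (g : Hom C M) → Hom M C →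
    SatisfiesAll C σ as → (∀ x → OccursIn x bs → OccursIn x as) →
    GroundOn (fun g ∘ σ) bs → GroundOn σ bs
  core-ground-reflect core g h sat bs⊆as ground x x∈bs with ground x x∈bs
  ... | c , gσx≡c =
    c , core-endo-reflects-constants core (h ∘ₕ g) (term-of-match sat (bs⊆as x x∈bs))
          (trans (cong (fun h) gσx≡c) (fixes h c))

theorem2 : (S : Sig) → let open Syntax S in
    (Σs : RuleSet) (D : Database) → RenamedApart Σs → HasCoreModel Σs D →
    (q : Query) → IsBNCQ q → AffectionSafe Σs q →
    (M : Interp) → IsUniversalModel Σs D M → NullsOnlyAtJAP Σs M →
    ((Σs , D ⊨c q) ⇔ (M ⊨ q))
theorem2 S Σs D _ (C₀ , isCoreModel₀) q (q⁻⊆q⁺ , _) safe M (M-model , M-univ) nulls =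
  mk⇔ core→chase chase→core
  where
  open QueryTransfer S

  core→chase : Σs , D ⊨c q → M ⊨ q
  core→chase (C , ((C-model , C-univ) , core) , σ , match@(sat , _)) =
    fun g ∘ σ , Match-transfer q g h match σ-ground
    where
    g : Hom C M
    g = toHom (C-univ M M-model)
    h : Hom M C
    h = toHom (M-univ C C-model)
    σ-ground : GroundOn σ (neg q)
    σ-ground = core-ground-reflect core g h sat q⁻⊆q⁺
      (affection-safe-ground q safe nulls (SatisfiesAll-hom g sat))

  chase→core : M ⊨ q → Σs , D ⊨c q
  chase→core (σ , match@(sat , _)) =
    C₀ , isCoreModel₀ , fun h ∘ σ ,
    Match-transfer q h g match (affection-safe-ground q safe nulls sat)
    where
    g : Hom C₀ M
    g = toHom (proj₂ (proj₁ isCoreModel₀) M M-model)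
    h : Hom M C₀
    h = toHom (M-univ C₀ (proj₁ (proj₁ isCoreModel₀)))
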